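{- Let $G$ be a group generated as a monoid by a subset $A\subseteq G$ closed under $G$-conjugation, and let $c\in G$ with $\mathrm{Red}_A(c)$ finite. Let $\prec$ be a $c$-compatible order of $A_c$, and suppose $\mathcal{P}_c(G,A)$ is totally well-covered with respect to $\prec$. Then for every $x,y\in G$ with $x\le_A y\le_A c$ there exists a unique $\prec$-rising reduced $A$-factorization of $x^{ -1}y$.
   Context: For $x\in G$, $\ell_A(x)$ is the least $k\ge 0$ such that $x$ is a product of $k$ elements of $A$; such a product with $k=\ell_A(x)$, written as a tuple, is a reduced $A$-factorization, and $\mathrm{Red}_A(x)$ is the set of these. $x\le_A y$ iff $\ell_A(x)+\ell_A(x^{ -1}y)=\ell_A(y)$, $\lessdot_A$ denotes a cover relation, $\mathcal{P}_g=[e,g]_A$ ordered by $\le_A$, and $A_g=\{a\in A: a\le_A g\}$. A factorization $(a_1,\dots,a_k)$ is $\prec$-rising if $a_i\preceq a_{i+1}$ for all $i$. A linear order $\prec$ on $A_c$ is $c$-compatible if every $g\le_A c$ with $\ell_A(g)=2$ has exactly one $\prec$-rising reduced $A$-factorization. For $a\in A_c$, $F_\prec(a;c)=\{g: a\lessdot_A g\le_A c$ and there is $a'\in A_c$ with $a'\prec a$, $a'\lessdot_A g\}$; $\mathcal{P}_c$ is well-covered with respect to $\prec$ if $F_\prec(a;c)=\emptyset$ exactly when $a=\min_\prec A_c$, and totally well-covered if for every $g\in\mathcal{P}_c$, $\mathcal{P}_g$ is well-covered with respect to the restriction of $\prec$ to $A_g$. -}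

module Defs where

open import Level using (Level; _⊔_)
open import Data.Nat using (ℕ; _+_; _≤_)
open import Data.Product using (Σ; _×_; _,_; ∃)
open import Data.Sum using (_⊎_)
open import Data.List using (List; []; _∷_; foldr; length)
open import Data.List.Relation.Unary.All using (All)
open import Data.List.Relation.Unary.Any using (Any)
open import Data.List.Relation.Binary.Pointwise using (Pointwise)
open import Relation.Nullary using (¬_)
open import Relation.Binary.PropositionalEquality using (_≡_)
open import Algebra.Bundles using (Group)

module Theory {c ℓ a : Level} (G : Group c ℓ) (A : Group.Carrier G → Set a) where
  open Group G

  prod : List Carrier → Carrier
  prod = foldr _∙_ ε

  IsFactorization : Carrier → List Carrier → Set (c ⊔ ℓ ⊔ a)
  IsFactorization x w = All A w × (prod w ≈ x)

  -- ℓ_A(x) ≡ k : k is the least length of an A-factorization of x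
  HasLength : Carrier → ℕ → Set (c ⊔ ℓ ⊔ a)
  HasLength x k =
    Σ (List Carrier) (λ w → IsFactorization x w × length w ≡ k)
    × (∀ w → IsFactorization x w → k ≤ length w)

  ConjugationClosed : Set (c ⊔ a)
  ConjugationClosed = ∀ g x → A x → A (g ∙ x ∙ g ⁻¹)

  RespectsEq : Set (c ⊔ ℓ ⊔ a)
  RespectsEq = ∀ {x y} → x ≈ y → A x → A y

  MonoidGenerates : Set (c ⊔ ℓ ⊔ a)
  MonoidGenerates = ∀ x → Σ (List Carrier) (λ w → IsFactorization x w)

  _≤A_ : Carrier → Carrier → Set (c ⊔ ℓ ⊔ a)
  x ≤A y = Σ ℕ λ i → Σ ℕ λ j → Σ ℕ λ k →
    HasLength x i × HasLength (x ⁻¹ ∙ y) j × HasLength y k × (i + j ≡ k)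

  _⋖A_ : Carrier → Carrier → Set (c ⊔ ℓ ⊔ a)
  x ⋖A y = (x ≤A y) × ¬ (x ≈ y) × (∀ z → x ≤A z → z ≤A y → (z ≈ x) ⊎ (z ≈ y))

  IsReduced : Carrier → List Carrier → Set (c ⊔ ℓ ⊔ a)
  IsReduced x w = IsFactorization x w × HasLength x (length w)

  -- Red_A(x) is finite (up to pointwise ≈ of words)
  RedFinite : Carrier → Set (c ⊔ ℓ ⊔ a)
  RedFinite x = Σ (List (List Carrier)) λ L →
    ∀ w → IsReduced x w → Any (Pointwise _≈_ w) L

  InA_ : Carrier → Carrier → Set (c ⊔ ℓ ⊔ a)
  InA_ g x = A x × (x ≤A g)

  ExactlyOne : ∀ {p} → (List Carrier → Set p) → Set (c ⊔ ℓ ⊔ p)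
  ExactlyOne P = Σ (List Carrier) λ w → P w × (∀ w' → P w' → Pointwise _≈_ w w')

  module Order {r : Level} (_≺_ : Carrier → Carrier → Set r) where

    _⪯_ : Carrier → Carrier → Set (ℓ ⊔ r)
    x ⪯ y = (x ≺ y) ⊎ (x ≈ y)

    IsLinearOrderOn : Carrier → Set (c ⊔ ℓ ⊔ a ⊔ r)
    IsLinearOrderOn g =
      (∀ {x y x' y'} → x ≈ x' → y ≈ y' → x ≺ y → x' ≺ y')
      × (∀ {x y} → InA_ g x → InA_ g y → x ≈ y → ¬ (x ≺ y))
      × (∀ {x y z} → InA_ g x → InA_ g y → InA_ g z → x ≺ y → y ≺ z → x ≺ z)
      × (∀ {x y} → InA_ g x → InA_ g y → (x ≺ y) ⊎ (x ≈ y) ⊎ (y ≺ x))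

    data Rising : List Carrier → Set (c ⊔ ℓ ⊔ r) where
      rising-[] : Rising []
      rising-[x] : ∀ x → Rising (x ∷ [])
      rising-∷ : ∀ x y w → x ⪯ y → Rising (y ∷ w) → Rising (x ∷ y ∷ w)

    RisingReduced : Carrier → List Carrier → Set (c ⊔ ℓ ⊔ a ⊔ r)
    RisingReduced x w = Rising w × IsReduced x w

    Compatible : Carrier → Set (c ⊔ ℓ ⊔ a ⊔ r)
    Compatible c₀ = ∀ g → g ≤A c₀ → HasLength g 2 → ExactlyOne (RisingReduced g)

    InF : Carrier → Carrier → Carrier → Set (c ⊔ ℓ ⊔ a ⊔ r)
    InF x c₀ g = (x ⋖A g) × (g ≤A c₀) × Σ Carrier λ x' → InA_ c₀ x' × (x' ≺ x) × (x' ⋖A g)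

    IsMin : Carrier → Carrier → Set (c ⊔ ℓ ⊔ a ⊔ r)
    IsMin c₀ x = InA_ c₀ x × (∀ y → InA_ c₀ y → x ⪯ y)

    WellCovered : Carrier → Set (c ⊔ ℓ ⊔ a ⊔ r)
    WellCovered c₀ = ∀ x → InA_ c₀ x →
      ((∀ g → ¬ InF x c₀ g) → IsMin c₀ x) × (IsMin c₀ x → ∀ g → ¬ InF x c₀ g)

    TotallyWellCovered : Carrier → Set (c ⊔ ℓ ⊔ a ⊔ r)
    TotallyWellCovered c₀ = ∀ g → ε ≤A g → g ≤A c₀ → WellCovered g

module Submission where

-- Finiteness of Red_A(c₀) makes ≺ well founded
-- on A_{c₀}. Total well-coveredness and compatibility show that the first letter of a rising
-- reduced word of g is ≺-minimal in A_g: first for two-letter words (by well-founded induction on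
-- competing first letters), then for all lengths. This gives uniqueness letter by letter, and
-- existence follows by an insertion sort that repairs a descent (a, b) with compatibility.
-- Finally x⁻¹y for x ≤ y ≤ c₀ is an element of [e, c₀], which gives the proposition.

open import Defs
open import Level using (Level)
open import Algebra.Bundles using (Group)
import Algebra.Properties.Group as GroupProperties
open import Data.Nat using (ℕ; zero; suc; _+_; _≤_; s≤s)
open import Data.Nat.Properties using (+-comm; +-cancelʳ-≤; +-cancelˡ-≤; ≤-antisym; suc-injective; m+1+n≢m)
open import Data.Product using (Σ; _×_; _,_; proj₁; proj₂)
open import Data.Sum using (_⊎_; inj₁; inj₂)
open import Data.Empty using (⊥; ⊥-elim)
open import Data.List using (List; []; _∷_; _++_; length; map; concat)
open import Data.List.Properties using (length-++; ++-assoc; ++-identityʳ; length-map; length-removeAt′)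
open import Data.List.Relation.Unary.All as All using (_∷_)
open import Data.List.Relation.Unary.All.Properties using (++⁺; ++⁻ˡ; ++⁻ʳ; map⁺)
open import Data.List.Relation.Unary.Any as Any using (Any; here; there; _─_)
open import Data.List.Relation.Unary.Any.Properties using (concat⁺)
open import Data.List.Relation.Binary.Pointwise using (Pointwise; []; _∷_)
open import Induction.WellFounded using (Acc; acc)
open import Relation.Nullary using (¬_)
open import Relation.Binary.PropositionalEquality as ≡ using (_≡_; cong; subst; subst₂)

module Factorizations {c ℓ a : Level} (G : Group c ℓ) (A : Group.Carrier G → Set a)
  (respA : Theory.RespectsEq G A) (conjA : Theory.ConjugationClosed G A) where
  open Group G
  open Theory G A
  open GroupProperties G using (∙-cancelˡ; ∙-cancelʳ; y≈x\\z; ⁻¹-involutive)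
  open import Relation.Binary.Reasoning.Setoid setoid

  prod-++ : ∀ u v → prod (u ++ v) ≈ prod u ∙ prod v
  prod-++ []      v = sym (identityˡ _)
  prod-++ (x ∷ u) v = trans (∙-congˡ (prod-++ u v)) (sym (assoc _ _ _))

  conj : Carrier → Carrier → Carrier
  conj h x = h ⁻¹ ∙ x ∙ h

  conj-ε : ∀ h → conj h ε ≈ ε
  conj-ε h = trans (∙-congʳ (identityʳ _)) (inverseˡ h)

  conj-∙ : ∀ h x y → conj h x ∙ conj h y ≈ conj h (x ∙ y)
  conj-∙ h x y = begin
    (h ⁻¹ ∙ x ∙ h) ∙ (h ⁻¹ ∙ y ∙ h)   ≈⟨ assoc _ _ _ ⟩
    h ⁻¹ ∙ x ∙ (h ∙ (h ⁻¹ ∙ y ∙ h))   ≈⟨ ∙-congˡ (trans (sym (assoc _ _ _)) (∙-congʳ (sym (assoc _ _ _)))) ⟩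
    h ⁻¹ ∙ x ∙ ((h ∙ h ⁻¹) ∙ y ∙ h)   ≈⟨ ∙-congˡ (∙-congʳ (trans (∙-congʳ (inverseʳ h)) (identityˡ y))) ⟩
    h ⁻¹ ∙ x ∙ (y ∙ h)                ≈⟨ trans (assoc _ _ _) (trans (∙-congˡ (sym (assoc _ _ _))) (sym (assoc _ _ _))) ⟩
    h ⁻¹ ∙ (x ∙ y) ∙ h                ∎

  conj-commute : ∀ h x → h ∙ conj h x ≈ x ∙ h
  conj-commute h x = begin
    h ∙ (h ⁻¹ ∙ x ∙ h)     ≈⟨ sym (assoc _ _ _) ⟩
    h ∙ (h ⁻¹ ∙ x) ∙ h     ≈⟨ ∙-congʳ (sym (assoc _ _ _)) ⟩
    (h ∙ h ⁻¹) ∙ x ∙ h     ≈⟨ ∙-congʳ (trans (∙-congʳ (inverseʳ h)) (identityˡ x)) ⟩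
    x ∙ h                  ∎

  prod-conj : ∀ h u → prod (map (conj h) u) ≈ conj h (prod u)
  prod-conj h []      = sym (conj-ε h)
  prod-conj h (x ∷ u) = trans (∙-congˡ (prod-conj h u)) (conj-∙ h x (prod u))

  A-conj : ∀ h x → A x → A (conj h x)
  A-conj h x ax = respA (∙-congˡ (⁻¹-involutive h)) (conjA (h ⁻¹) x ax)

  IsFactorization-resp : ∀ {x y w} → x ≈ y → IsFactorization x w → IsFactorization y w
  IsFactorization-resp e (as , p) = as , trans p e

  HasLength-resp : ∀ {x y k} → x ≈ y → HasLength x k → HasLength y k
  HasLength-resp e ((w , f , l) , least) =
    (w , IsFactorization-resp e f , l) , λ w' f' → least w' (IsFactorization-resp (sym e) f')

  HasLength-unique : ∀ {x k k'} → HasLength x k → HasLength x k' → k ≡ k'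
  HasLength-unique ((w , f , l) , least) ((w' , f' , l') , least') =
    ≤-antisym (subst (_ ≤_) l' (least w' f')) (subst (_ ≤_) l (least' w f))

  IsReduced-resp : ∀ {x y w} → x ≈ y → IsReduced x w → IsReduced y w
  IsReduced-resp e (f , h) = IsFactorization-resp e f , HasLength-resp e h

  reduced-length : ∀ {x w w'} → IsReduced x w → IsReduced x w' → length w ≡ length w'
  reduced-length (_ , h) (_ , h') = HasLength-unique h h'

  private
    length-++₃ : ∀ (p m s : List Carrier) → length (p ++ m ++ s) ≡ length p + (length m + length s)
    length-++₃ p m s = ≡.trans (length-++ p) (cong (length p +_) (length-++ m))

  splice : ∀ {y} p m s {m'} → IsFactorization y (p ++ m ++ s) → IsFactorization (prod m) m' →
    IsFactorization y (p ++ m' ++ s)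
  splice {y} p m s {m'} (as , eq) (as' , eq') =
    ++⁺ (++⁻ˡ p as) (++⁺ as' (++⁻ʳ m (++⁻ʳ p as))) , (begin
      prod (p ++ m' ++ s)          ≈⟨ prod-++ p (m' ++ s) ⟩
      prod p ∙ prod (m' ++ s)      ≈⟨ ∙-congˡ (trans (prod-++ m' s) (∙-congʳ eq')) ⟩
      prod p ∙ (prod m ∙ prod s)   ≈⟨ ∙-congˡ (sym (prod-++ m s)) ⟩
      prod p ∙ prod (m ++ s)       ≈⟨ sym (prod-++ p (m ++ s)) ⟩
      prod (p ++ m ++ s)           ≈⟨ eq ⟩
      y                            ∎)

  -- Every segment of a reduced word is a reduced word of its own product:
  -- a shorter factorization of the segment would splice into a shorter one of y.
  segment-reduced : ∀ {y} p m s → IsReduced y (p ++ m ++ s) → IsReduced (prod m) m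
  segment-reduced p m s (f@(as , _) , (_ , least)) = fm , ((m , fm , ≡.refl) , shortest)
    where
    fm : IsFactorization (prod m) m
    fm = ++⁻ˡ m (++⁻ʳ p as) , refl
    shortest : ∀ w → IsFactorization (prod m) w → length m ≤ length w
    shortest w fw = +-cancelʳ-≤ (length s) _ _ (+-cancelˡ-≤ (length p) _ _
      (subst₂ _≤_ (length-++₃ p m s) (length-++₃ p w s) (least (p ++ w ++ s) (splice p m s f fw))))

  replace-reduced : ∀ {y} p m s m' → IsReduced y (p ++ m ++ s) → IsReduced (prod m) m' →
    IsReduced y (p ++ m' ++ s)
  replace-reduced {y} p m s m' R@(f , h) R'@(f' , _) =
    splice p m s f f' , subst (HasLength y) same-length h
    where
    same-length : length (p ++ m ++ s) ≡ length (p ++ m' ++ s)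
    same-length = ≡.trans (length-++₃ p m s)
      (≡.trans (cong (λ k → length p + (k + length s)) (reduced-length (segment-reduced p m s R) R'))
               (≡.sym (length-++₃ p m' s)))

  prefix-reduced : ∀ {y} u v → IsReduced y (u ++ v) → IsReduced (prod u) u
  prefix-reduced u v = segment-reduced [] u v

  suffix-reduced : ∀ {y} u v → IsReduced y (u ++ v) → IsReduced (prod v) v
  suffix-reduced {y} u v R =
    segment-reduced u v [] (subst (λ t → IsReduced y (u ++ t)) (≡.sym (++-identityʳ v)) R)

  replace-prefix : ∀ {y} u v u' → IsReduced y (u ++ v) → IsReduced (prod u) u' → IsReduced y (u' ++ v)
  replace-prefix u v u' = replace-reduced [] u v u'

  replace-suffix : ∀ {y} u v v' → IsReduced y (u ++ v) → IsReduced (prod v) v' → IsReduced y (u ++ v')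
  replace-suffix {y} u v v' R R' =
    subst (λ t → IsReduced y (u ++ t)) (++-identityʳ v')
      (replace-reduced u v [] v' (subst (λ t → IsReduced y (u ++ t)) (≡.sym (++-identityʳ v)) R) R')

  hurwitz : ∀ {y} u v → IsReduced y (u ++ v) → IsReduced y (v ++ map (conj (prod v)) u)
  hurwitz {y} u v ((as , eq) , h) =
    (++⁺ (++⁻ʳ u as) (map⁺ (All.map (A-conj (prod v) _) (++⁻ˡ u as))) , eq') ,
    subst (HasLength y) same-length h
    where
    eq' : prod (v ++ map (conj (prod v)) u) ≈ y
    eq' = begin
      prod (v ++ map (conj (prod v)) u)    ≈⟨ prod-++ v _ ⟩
      prod v ∙ prod (map (conj (prod v)) u) ≈⟨ ∙-congˡ (prod-conj (prod v) u) ⟩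
      prod v ∙ conj (prod v) (prod u)      ≈⟨ conj-commute (prod v) (prod u) ⟩
      prod u ∙ prod v                      ≈⟨ sym (prod-++ u v) ⟩
      prod (u ++ v)                        ≈⟨ eq ⟩
      y                                    ∎
    same-length : length (u ++ v) ≡ length (v ++ map (conj (prod v)) u)
    same-length = ≡.trans (length-++ u) (≡.trans (+-comm (length u) (length v))
      (≡.trans (cong (length v +_) (≡.sym (length-map (conj (prod v)) u))) (≡.sym (length-++ v))))

  tail-reduced : ∀ {g x x' t t'} → IsReduced g (x ∷ t) → IsReduced g (x' ∷ t') → x ≈ x' →
    IsReduced (prod t) t'
  tail-reduced {x = x} {x'} {t} {t'} R R' x≈x' =
    IsReduced-resp (∙-cancelˡ x (prod t') (prod t)
      (trans (∙-congʳ x≈x') (trans (proj₂ (proj₁ R')) (sym (proj₂ (proj₁ R))))))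
      (suffix-reduced (x' ∷ []) t' R')

  head-resp : ∀ {g x y t} → A x → y ≈ x → IsReduced g (y ∷ t) → IsReduced g (x ∷ t)
  head-resp {y = y} {t} ax y≈x R =
    replace-prefix (y ∷ []) t (_ ∷ []) R ((ax ∷ All.[] , ∙-congʳ (sym y≈x)) , proj₂ (prefix-reduced (y ∷ []) t R))

  suffix-quotient : ∀ {x y} u v → IsReduced y (u ++ v) → prod u ≈ x → IsReduced (x ⁻¹ ∙ y) v
  suffix-quotient {x} {y} u v R pu = IsReduced-resp prod-v (suffix-reduced u v R)
    where
    prod-v : prod v ≈ x ⁻¹ ∙ y
    prod-v = trans (y≈x\\z (prod u) (prod v) y (trans (sym (prod-++ u v)) (proj₂ (proj₁ R))))
                   (∙-congʳ (⁻¹-cong pu))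

  ≤A-intro : ∀ {x y} u v → IsReduced y (u ++ v) → prod u ≈ x → x ≤A y
  ≤A-intro u v R pu = length u , length v , length (u ++ v) ,
    HasLength-resp pu (proj₂ (prefix-reduced u v R)) , proj₂ (suffix-quotient u v R pu) , proj₂ R ,
    ≡.sym (length-++ u)

  ≤A-elim : ∀ {x y} → x ≤A y → Σ (List Carrier) λ u → Σ (List Carrier) λ v → IsReduced y (u ++ v) × prod u ≈ x
  ≤A-elim {x} {y} (i , j , k , ((u , (as , pu) , lu) , _) , ((v , (bs , pv) , lv) , _) , hy , i+j≡k) =
    u , v , ((++⁺ as bs , prod-uv) , subst (HasLength y) k≡ hy) , pu
    where
    prod-uv : prod (u ++ v) ≈ y
    prod-uv = begin
      prod (u ++ v)     ≈⟨ prod-++ u v ⟩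
      prod u ∙ prod v   ≈⟨ ∙-cong pu pv ⟩
      x ∙ (x ⁻¹ ∙ y)   ≈⟨ sym (assoc _ _ _) ⟩
      (x ∙ x ⁻¹) ∙ y   ≈⟨ ∙-congʳ (inverseʳ x) ⟩
      ε ∙ y             ≈⟨ identityˡ y ⟩
      y                 ∎
    k≡ : k ≡ length (u ++ v)
    k≡ = ≡.trans (≡.sym i+j≡k) (≡.trans (≡.cong₂ _+_ (≡.sym lu) (≡.sym lv)) (≡.sym (length-++ u)))

  proper-prefix : ∀ {y} u b v → IsReduced y (u ++ b ∷ v) → ¬ HasLength y (length u)
  proper-prefix u b v (_ , h) h' =
    m+1+n≢m (length u) (≡.trans (≡.sym (length-++ u)) (HasLength-unique h h'))

  prod-whole : ∀ {y} u → IsReduced y (u ++ []) → prod u ≈ y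
  prod-whole {y} u R = subst (λ w → prod w ≈ y) (++-identityʳ u) (proj₂ (proj₁ R))

  ≤A-same-length : ∀ {g' g k} → g' ≤A g → HasLength g' k → HasLength g k → g' ≈ g
  ≤A-same-length g'≤g h' h with ≤A-elim g'≤g
  ... | u , [] , R , pu = trans (sym pu) (prod-whole u R)
  ... | u , b ∷ v , R , pu = ⊥-elim (proper-prefix u b v R
          (subst (HasLength _) (HasLength-unique h' (HasLength-resp pu (proj₂ (prefix-reduced u (b ∷ v) R)))) h))

  strictly-between : ∀ {x y} u b b' v → IsReduced y (u ++ b ∷ b' ∷ v) → prod u ≈ x →
    (x ≤A prod (u ++ b ∷ [])) × (prod (u ++ b ∷ []) ≤A y) ×
    ¬ (prod (u ++ b ∷ []) ≈ x) × ¬ (prod (u ++ b ∷ []) ≈ y)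
  strictly-between {x} {y} u b b' v R pu =
    ≤A-intro u (b ∷ []) Rz pu , ≤A-intro (u ++ b ∷ []) (b' ∷ v) R' refl ,
    (λ z≈x → proper-prefix u b [] Rz
               (HasLength-resp (trans pu (sym z≈x)) (proj₂ (prefix-reduced u (b ∷ []) Rz)))) ,
    (λ z≈y → proper-prefix (u ++ b ∷ []) b' v R' (HasLength-resp z≈y (proj₂ Rz)))
    where
    R' : IsReduced y ((u ++ b ∷ []) ++ b' ∷ v)
    R' = subst (IsReduced y) (≡.sym (++-assoc u (b ∷ []) (b' ∷ v))) R
    Rz : IsReduced (prod (u ++ b ∷ [])) (u ++ b ∷ [])
    Rz = prefix-reduced (u ++ b ∷ []) (b' ∷ v) R'

  cover-word : ∀ {x y} → x ⋖A y →
    Σ (List Carrier) λ u → Σ Carrier λ b → IsReduced y (u ++ b ∷ []) × prod u ≈ x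
  cover-word (x≤y , x≉y , between) with ≤A-elim x≤y
  ... | u , [] , R , pu = ⊥-elim (x≉y (trans (sym pu) (prod-whole u R)))
  ... | u , b ∷ [] , R , pu = u , b , R , pu
  ... | u , b ∷ b' ∷ v , R , pu with strictly-between u b b' v R pu
  ... | x≤z , z≤y , z≉x , z≉y with between _ x≤z z≤y
  ... | inj₁ z≈x = ⊥-elim (z≉x z≈x)
  ... | inj₂ z≈y = ⊥-elim (z≉y z≈y)

  cover-lengths : ∀ {x y} → x ⋖A y → Σ ℕ λ k → HasLength x k × HasLength y (suc k)
  cover-lengths cv with cover-word cv
  ... | u , b , R , pu = length u , HasLength-resp pu (proj₂ (prefix-reduced u (b ∷ []) R)) ,
        subst (HasLength _) (≡.trans (length-++ u) (+-comm (length u) 1)) (proj₂ R)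

  length-one : ∀ (u : List Carrier) → length u ≡ 1 → Σ Carrier λ y → u ≡ y ∷ []
  length-one (y ∷ []) _ = y , ≡.refl

  cover-of-letter : ∀ {x y} → A x → HasLength x 1 → x ⋖A y → Σ Carrier λ b → IsReduced y (x ∷ b ∷ [])
  cover-of-letter ax hx cv with cover-word cv
  ... | u , b , R , pu with length-one u (HasLength-unique (HasLength-resp pu (proj₂ (prefix-reduced u (b ∷ []) R))) hx)
  ... | y , ≡.refl = b , head-resp ax (trans (sym (identityʳ y)) pu) R

  -- Let ℓ(g) = 2. If a letter x is covered by some g' ≤ g, then g' is g itself, so every
  -- letter x'' covered by g' starts a reduced word (x'', b'') of g.
  covered-in-length-two : ∀ {g g' x x''} → HasLength g 2 → A x → HasLength x 1 → x ⋖A g' → g' ≤A g →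
    A x'' → x'' ⋖A g' → Σ Carrier λ b'' → IsReduced g (x'' ∷ b'' ∷ [])
  covered-in-length-two hg ax hx x⋖g' g'≤g ax'' x''⋖g' with cover-of-letter ax hx x⋖g' | cover-lengths x''⋖g'
  ... | _ , Rg' | k , hx'' , hg' with cover-of-letter ax'' (subst (HasLength _) k≡1 hx'') x''⋖g'
    where
    k≡1 : k ≡ 1
    k≡1 = suc-injective (HasLength-unique hg' (proj₂ Rg'))
  ... | b'' , R'' = b'' , IsReduced-resp (≤A-same-length g'≤g (proj₂ Rg') hg) R''

  head-letter : ∀ {g x t} → IsReduced g (x ∷ t) → A x
  head-letter ((ax ∷ _ , _) , _) = ax

  head-below : ∀ {g x t} → IsReduced g (x ∷ t) → InA_ g x
  head-below {x = x} {t} R = head-letter R , ≤A-intro (x ∷ []) t R (identityʳ x)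

  letter-injective : ∀ {x y} → prod (x ∷ []) ≈ prod (y ∷ []) → x ≈ y
  letter-injective {x} {y} = ∙-cancelʳ ε x y

  head-length : ∀ {g x t} → IsReduced g (x ∷ t) → HasLength x 1
  head-length {x = x} {t} R = HasLength-resp (identityʳ x) (proj₂ (prefix-reduced (x ∷ []) t R))

module RisingFactorizations {c ℓ a r : Level} (G : Group c ℓ) (A : Group.Carrier G → Set a)
  (respA : Theory.RespectsEq G A) (conjA : Theory.ConjugationClosed G A)
  (c₀ : Group.Carrier G) (finite : Theory.RedFinite G A c₀)
  (_≺_ : Group.Carrier G → Group.Carrier G → Set r)
  (linear : Theory.Order.IsLinearOrderOn G A _≺_ c₀)
  (compatible : Theory.Order.Compatible G A _≺_ c₀)
  (totally : Theory.Order.TotallyWellCovered G A _≺_ c₀) where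
  open Group G
  open Theory G A
  open Order _≺_
  open Factorizations G A respA conjA

  Ac : Carrier → Set _
  Ac = InA_ c₀

  ≺-resp : ∀ {x y x' y'} → x ≈ x' → y ≈ y' → x ≺ y → x' ≺ y'
  ≺-resp = proj₁ linear

  ≺-trans : ∀ {x y z} → Ac x → Ac y → Ac z → x ≺ y → y ≺ z → x ≺ z
  ≺-trans = proj₁ (proj₂ (proj₂ linear))

  ≺-trichotomy : ∀ {x y} → Ac x → Ac y → (x ≺ y) ⊎ (x ≈ y) ⊎ (y ≺ x)
  ≺-trichotomy = proj₂ (proj₂ (proj₂ linear))

  ≺-irrefl : ∀ {x y} → Ac x → Ac y → x ≈ y → ¬ (x ≺ y)
  ≺-irrefl = proj₁ (proj₂ linear)

  ≺⇒¬⪰ : ∀ {x y} → Ac x → Ac y → x ≺ y → ¬ (y ⪯ x)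
  ≺⇒¬⪰ xA yA x≺y (inj₁ y≺x) = ≺-irrefl xA xA refl (≺-trans xA yA xA x≺y y≺x)
  ≺⇒¬⪰ xA yA x≺y (inj₂ y≈x) = ≺-irrefl xA xA refl (≺-resp refl y≈x x≺y)

  ¬≻⇒⪯ : ∀ {x y} → Ac x → Ac y → ¬ (y ≺ x) → x ⪯ y
  ¬≻⇒⪯ xA yA y⊀x with ≺-trichotomy xA yA
  ... | inj₁ x≺y = inj₁ x≺y
  ... | inj₂ (inj₁ x≈y) = inj₂ x≈y
  ... | inj₂ (inj₂ y≺x) = ⊥-elim (y⊀x y≺x)

  ⪯-trans : ∀ {x y z} → Ac x → Ac y → Ac z → x ⪯ y → y ⪯ z → x ⪯ z
  ⪯-trans xA yA zA (inj₁ x≺y) (inj₁ y≺z) = inj₁ (≺-trans xA yA zA x≺y y≺z)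
  ⪯-trans xA yA zA (inj₁ x≺y) (inj₂ y≈z) = inj₁ (≺-resp refl y≈z x≺y)
  ⪯-trans xA yA zA (inj₂ x≈y) (inj₁ y≺z) = inj₁ (≺-resp (sym x≈y) refl y≺z)
  ⪯-trans xA yA zA (inj₂ x≈y) (inj₂ y≈z) = inj₂ (trans x≈y y≈z)

  -- w is an initial segment of a reduced word of c₀, i.e. prod w lies in [e, c₀] and w is reduced.
  Initial : List Carrier → Set _
  Initial w = Σ (List Carrier) λ v → IsReduced c₀ (w ++ v)

  Initial-reduced : ∀ {g w w'} → IsReduced g w → Initial w → IsReduced g w' → Initial w'
  Initial-reduced {w = w} {w'} R (v , Rc) R' = v , replace-prefix w v w' Rc (IsReduced-resp (sym (proj₂ (proj₁ R))) R')

  ≤c₀⇒Initial : ∀ {g w} → g ≤A c₀ → IsReduced g w → Initial w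
  ≤c₀⇒Initial {w = w} g≤c₀ R with ≤A-elim g≤c₀
  ... | p , q , Rc , pp = q , replace-prefix p q w Rc (IsReduced-resp (sym pp) R)

  Initial-prefix : ∀ u t → Initial (u ++ t) → Initial u
  Initial-prefix u t (v , Rc) = t ++ v , subst (IsReduced c₀) (++-assoc u t v) Rc

  -- Suffixes are initial as well, by a Hurwitz move moving the prefix to the end.
  Initial-suffix : ∀ u t → Initial (u ++ t) → Initial t
  Initial-suffix u t (v , Rc) = _ , subst (IsReduced c₀) (++-assoc t v _)
     (hurwitz u (t ++ v) (subst (IsReduced c₀) (++-assoc u t v) Rc))

  Initial⇒≤c₀ : ∀ {g w} → IsReduced g w → Initial w → g ≤A c₀
  Initial⇒≤c₀ {w = w} R (v , Rc) = ≤A-intro w v Rc (proj₂ (proj₁ R))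

  A-below : ∀ {g w x} → IsReduced g w → Initial w → InA_ g x → Ac x
  A-below R I (ax , x≤g) with ≤A-elim x≤g
  ... | u , v , Ruv , pu with Initial-reduced R I Ruv
  ... | v' , Rc = ax , ≤A-intro u (v ++ v') (subst (IsReduced c₀) (++-assoc u v v') Rc) pu

  head-in-Ac : ∀ {g x t} → IsReduced g (x ∷ t) → Initial (x ∷ t) → Ac x
  head-in-Ac R (_ , Rc) = head-below Rc

  minimal-if-F-empty : ∀ {g w x} → IsReduced g w → Initial w → InA_ g x →
    (∀ g' → ¬ InF x g g') → ∀ y → InA_ g y → ¬ (y ≺ x)
  minimal-if-F-empty {w = w} R I xAg noF y yAg y≺x =
    ≺⇒¬⪰ (A-below R I yAg) (A-below R I xAg) y≺x (proj₂ (proj₁ (wellCovered _ xAg) noF) y yAg)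
    where
    wellCovered : WellCovered _
    wellCovered = totally _ (≤A-intro [] w R refl) (Initial⇒≤c₀ R I)

  -- ≺ restricted to A_{c₀}; it is well founded because A_{c₀} is finite.
  _⊏_ : Carrier → Carrier → Set _
  y ⊏ x = Ac y × y ≺ x

  -- A finite list containing A_{c₀} up to ≈: ε and the letters of the finitely many reduced words
  -- of c₀ (every x ∈ A_{c₀} is ε or starts a reduced word of c₀).
  candidates : List Carrier
  candidates = ε ∷ concat (proj₁ finite)

  candidates-cover : ∀ x → Ac x → Any (x ≈_) candidates
  candidates-cover x (ax , x≤c₀) with ≤A-elim x≤c₀
  ... | [] , v , R , pu = here (sym pu)
  ... | y ∷ [] , v , R , pu = there (concat⁺ (Any.map head≈ (proj₂ finite (y ∷ v) R)))
    where
    head≈ : ∀ {w} → Pointwise _≈_ (y ∷ v) w → Any (x ≈_) w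
    head≈ (y≈ ∷ _) = here (trans (trans (sym pu) (identityʳ y)) y≈)
  ... | y ∷ y' ∷ u , v , R , pu
      with proj₂ (HasLength-resp pu (proj₂ (prefix-reduced (y ∷ y' ∷ u) v R))) (x ∷ []) (ax ∷ All.[] , identityʳ x)
  ... | s≤s ()

  ─-keeps : ∀ {q s} {Q : Carrier → Set q} {S : Carrier → Set s} {N : List Carrier} (p : Any Q N) →
    Any S N → (∀ {e} → S e → Q e → ⊥) → Any S (N ─ p)
  ─-keeps (here q)  (here s)  incompatible = ⊥-elim (incompatible s q)
  ─-keeps (here q)  (there s) incompatible = s
  ─-keeps (there p) (here s)  incompatible = here s
  ─-keeps (there p) (there s) incompatible = there (─-keeps p s incompatible)

  -- If a list of length n contains all ⊏-predecessors of x up to ≈, then x is accessible.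
  -- (Induction on n: the predecessors of a predecessor y avoid the entry for y.)
  accessible-if-covered : ∀ n (N : List Carrier) → length N ≡ n → ∀ x → Ac x →
    (∀ y → y ⊏ x → Any (y ≈_) N) → Acc _⊏_ x
  accessible-if-covered zero [] _ x _ covered = acc λ {y} y⊏x → nothing (covered y y⊏x)
    where
    nothing : ∀ {y} → Any (y ≈_) [] → Acc _⊏_ y
    nothing ()
  accessible-if-covered (suc n) N N≡ x xA covered = acc λ {y} y⊏x@(yA , y≺x) →
    let entry = covered y y⊏x in
    accessible-if-covered n (N ─ entry) (suc-injective (≡.trans (≡.sym (length-removeAt′ N (Any.index entry))) N≡)) y yA
      λ z (zA , z≺y) → ─-keeps entry (covered z (zA , ≺-trans zA yA xA z≺y y≺x))
        λ z≈e y≈e → ≺-irrefl zA yA (trans z≈e (sym y≈e)) z≺y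

  ⊏-wellFounded : ∀ x → Ac x → Acc _⊏_ x
  ⊏-wellFounded x xA = accessible-if-covered _ candidates ≡.refl x xA (λ y (yA , _) → candidates-cover y yA)

  ⪯-resp : ∀ {x y x' y'} → x ≈ x' → y ≈ y' → x ⪯ y → x' ⪯ y'
  ⪯-resp x≈x' y≈y' (inj₁ x≺y) = inj₁ (≺-resp x≈x' y≈y' x≺y)
  ⪯-resp x≈x' y≈y' (inj₂ x≈y) = inj₂ (trans (sym x≈x') (trans x≈y y≈y'))

  rising-first : ∀ {x y w} → Rising (x ∷ y ∷ w) → x ⪯ y
  rising-first (rising-∷ _ _ _ x⪯y _) = x⪯y

  compatible-head : ∀ {g x b a₁ a₂} → g ≤A c₀ → HasLength g 2 →
    RisingReduced g (x ∷ b ∷ []) → RisingReduced g (a₁ ∷ a₂ ∷ []) → x ≈ a₁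
  compatible-head g≤c₀ hg RR RR' with compatible _ g≤c₀ hg
  ... | _ , _ , unique with unique _ RR | unique _ RR'
  ... | w₀≈x ∷ _ | w₀≈a₁ ∷ _ = trans (sym w₀≈x) w₀≈a₁

  module PairMinimality {g a₁ a₂} (RR : RisingReduced g (a₁ ∷ a₂ ∷ [])) (I : Initial (a₁ ∷ a₂ ∷ [])) where
    R : IsReduced g (a₁ ∷ a₂ ∷ [])
    R = proj₂ RR

    -- Since ℓ(g) = 2, an element g' ∈ F(x; g) for a letter x starting a reduced two-letter word
    -- of g is g itself, so it yields a letter x'' ≺ x starting another reduced two-letter word of g.
    smaller-head : ∀ {x b g'} → IsReduced g (x ∷ b ∷ []) → InF x g g' →
      Σ Carrier λ x'' → Σ Carrier λ b'' → Ac x'' × x'' ≺ x × IsReduced g (x'' ∷ b'' ∷ [])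
    smaller-head Rx (x⋖g' , g'≤g , x'' , x''Ag , x''≺x , x''⋖g') =
      x'' , proj₁ word , A-below R I x''Ag , x''≺x , proj₂ word
      where
      word : Σ Carrier λ b'' → IsReduced g (x'' ∷ b'' ∷ [])
      word = covered-in-length-two (proj₂ R) (head-letter Rx) (head-length Rx) x⋖g' g'≤g (proj₁ x''Ag) x''⋖g'

    -- By induction on x: F(x; g)
    -- is empty by the previous lemma, so x is minimal in A_g, hence (x, b) is rising and
    -- compatibility forces x ≈ a₁.
    no-smaller-head : ∀ x → Acc _⊏_ x → ∀ b → IsReduced g (x ∷ b ∷ []) → ¬ (x ≺ a₁)
    no-smaller-head x (acc rec) b Rx x≺a₁ = ≺-irrefl xAc a₁Ac x≈a₁ x≺a₁
      where
      xAc : Ac x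
      xAc = A-below R I (head-below Rx)
      a₁Ac : Ac a₁
      a₁Ac = head-in-Ac R I
      F-empty : ∀ g' → ¬ InF x g g'
      F-empty g' F =
        let (x'' , b'' , x''Ac , x''≺x , R'') = smaller-head Rx F in
        no-smaller-head x'' (rec (x''Ac , x''≺x)) b'' R'' (≺-trans x''Ac xAc a₁Ac x''≺x x≺a₁)
      bAg : InA_ g b
      bAg = head-below (hurwitz (x ∷ []) (b ∷ []) Rx)
      x⪯b : x ⪯ b
      x⪯b = ¬≻⇒⪯ xAc (A-below R I bAg) (minimal-if-F-empty R I (head-below Rx) F-empty b bAg)
      x≈a₁ : x ≈ a₁
      x≈a₁ = compatible-head (Initial⇒≤c₀ R I) (proj₂ R) (rising-∷ x b [] x⪯b (rising-[x] b) , Rx) RR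

    head-minimal : ∀ x → InA_ g x → ¬ (x ≺ a₁)
    head-minimal = minimal-if-F-empty R I (head-below R) F-empty
      where
      F-empty : ∀ g' → ¬ InF a₁ g g'
      F-empty g' F =
        let (x' , b' , x'Ac , x'≺a₁ , R') = smaller-head R F in
        no-smaller-head x' (⊏-wellFounded x' x'Ac) b' R' x'≺a₁

  -- By induction on the length: for g' ∈ F(a₁; g), g' has a reduced word (a₁, b) extending to
  -- one (a₁, b, …) of g; a₂ ⪯ b by induction for the tail, so (a₁, b) is rising and the
  -- two-letter case applies to g'.
  rising-head-minimal : ∀ {g a₁ a₂} t → RisingReduced g (a₁ ∷ a₂ ∷ t) → Initial (a₁ ∷ a₂ ∷ t) →
    ∀ x → InA_ g x → ¬ (x ≺ a₁)
  rising-head-minimal [] RR I = PairMinimality.head-minimal RR I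
  rising-head-minimal {g} {a₁} {a₂} (a₃ ∷ t) (rising-∷ _ _ _ a₁⪯a₂ ris , R) I =
    minimal-if-F-empty R I (head-below R) F-empty
    where
    tail : List Carrier
    tail = a₂ ∷ a₃ ∷ t
    Rtail : IsReduced (prod tail) tail
    Rtail = suffix-reduced (a₁ ∷ []) tail R
    Itail : Initial tail
    Itail = Initial-suffix (a₁ ∷ []) tail I
    F-empty : ∀ g' → ¬ InF a₁ g g'
    F-empty g' (a₁⋖g' , g'≤g , a' , a'Ag , a'≺a₁ , a'⋖g')
      with cover-of-letter (head-letter R) (head-length R) a₁⋖g' | ≤A-elim g'≤g
    ... | b , Rg' | p , q , Rpq , pp =
      PairMinimality.head-minimal (rising-∷ a₁ b [] a₁⪯b (rising-[x] b) , Rg') I' a' (proj₁ a'Ag , proj₁ a'⋖g') a'≺a₁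
      where
      Rg : IsReduced g (a₁ ∷ b ∷ q)
      Rg = replace-prefix p q (a₁ ∷ b ∷ []) Rpq (IsReduced-resp (sym pp) Rg')
      I' : Initial (a₁ ∷ b ∷ [])
      I' = Initial-prefix (a₁ ∷ b ∷ []) q (Initial-reduced R I Rg)
      bA : InA_ (prod tail) b
      bA = head-below (tail-reduced R Rg refl)
      a₂Ac : Ac a₂
      a₂Ac = head-in-Ac Rtail Itail
      bAc : Ac b
      bAc = A-below Rtail Itail bA
      a₁⪯b : a₁ ⪯ b
      a₁⪯b = ⪯-trans (head-in-Ac R I) a₂Ac bAc a₁⪯a₂
               (¬≻⇒⪯ a₂Ac bAc (rising-head-minimal t (ris , Rtail) Itail b bA))

  -- Uniqueness: two rising reduced words of g agree letter by letter; their first letters are both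
  -- minimal in A_g, and the tails are rising reduced words of one element.
  rising-unique : ∀ {g} w w' → Initial w → RisingReduced g w → RisingReduced g w' → Pointwise _≈_ w w'
  rising-unique [] [] _ _ _ = []
  rising-unique (x ∷ []) (x' ∷ []) _ (_ , R) (_ , R') =
    letter-injective (trans (proj₂ (proj₁ R)) (sym (proj₂ (proj₁ R')))) ∷ []
  rising-unique (a₁ ∷ a₂ ∷ t) (a₁' ∷ a₂' ∷ t') I RR@(rising-∷ _ _ _ _ ris , R) RR'@(rising-∷ _ _ _ _ ris' , R') =
    a₁≈a₁' ∷ rising-unique (a₂ ∷ t) (a₂' ∷ t') (Initial-suffix (a₁ ∷ []) _ I)
               (ris , suffix-reduced (a₁ ∷ []) _ R) (ris' , tail-reduced R R' a₁≈a₁')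
    where
    I' : Initial (a₁' ∷ a₂' ∷ t')
    I' = Initial-reduced R I R'
    a₁≈a₁' : a₁ ≈ a₁'
    a₁≈a₁' with ≺-trichotomy (head-in-Ac R I) (head-in-Ac R' I')
    ... | inj₁ a₁≺a₁' = ⊥-elim (rising-head-minimal t' RR' I' a₁ (head-below R) a₁≺a₁')
    ... | inj₂ (inj₁ a₁≈a₁') = a₁≈a₁'
    ... | inj₂ (inj₂ a₁'≺a₁) = ⊥-elim (rising-head-minimal t RR I a₁' (head-below R') a₁'≺a₁)
  rising-unique [] (_ ∷ _) _ (_ , R) (_ , R') with reduced-length R R'
  ... | ()
  rising-unique (_ ∷ _) [] _ (_ , R) (_ , R') with reduced-length R R'
  ... | ()
  rising-unique (_ ∷ []) (_ ∷ _ ∷ _) _ (_ , R) (_ , R') with reduced-length R R'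
  ... | ()
  rising-unique (_ ∷ _ ∷ _) (_ ∷ []) _ (_ , R) (_ , R') with reduced-length R R'
  ... | ()

  length-two : ∀ (w : List Carrier) → length w ≡ 2 → Σ Carrier λ m → Σ Carrier λ m' → w ≡ m ∷ m' ∷ []
  length-two (m ∷ m' ∷ []) _ = m , m' , ≡.refl

  -- If b ≺ a for a reduced word (a, b) of h in the interval, compatibility rewrites h as a rising
  -- word (m, m') with m ≺ a: a ∈ A_h gives a ⊀ m by minimality, and m ≈ a would force a ⪯ b.
  descend : ∀ {h a b} → IsReduced h (a ∷ b ∷ []) → Initial (a ∷ b ∷ []) → b ≺ a →
    Σ Carrier λ m → Σ Carrier λ m' → RisingReduced h (m ∷ m' ∷ []) × m ≺ a
  descend {h} {a} {b} R I b≺a with compatible _ (Initial⇒≤c₀ R I) (proj₂ R)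
  ... | w₀ , RR₀ , _ with length-two w₀ (≡.sym (reduced-length R (proj₂ RR₀)))
  ... | m , m' , ≡.refl = m , m' , RR₀ , m≺a
    where
    R₀ : IsReduced h (m ∷ m' ∷ [])
    R₀ = proj₂ RR₀
    I₀ : Initial (m ∷ m' ∷ [])
    I₀ = Initial-reduced R I R₀
    aAc : Ac a
    aAc = head-in-Ac R I
    bAc : Ac b
    bAc = A-below R I (head-below (hurwitz (a ∷ []) (b ∷ []) R))
    m≈a⇒a⪯b : m ≈ a → a ⪯ b
    m≈a⇒a⪯b m≈a =
      ⪯-resp m≈a (letter-injective (proj₂ (proj₁ (tail-reduced R R₀ (sym m≈a))))) (rising-first (proj₁ RR₀))
    m≺a : m ≺ a
    m≺a with ≺-trichotomy (head-in-Ac R₀ I₀) aAc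
    ... | inj₁ m≺a = m≺a
    ... | inj₂ (inj₁ m≈a) = ⊥-elim (≺⇒¬⪰ bAc aAc b≺a (m≈a⇒a⪯b m≈a))
    ... | inj₂ (inj₂ a≺m) = ⊥-elim (PairMinimality.head-minimal RR₀ I₀ a (head-below R) a≺m)

  RisingFactorization : Carrier → Set _
  RisingFactorization g = Σ (List Carrier) (RisingReduced g)

  -- Insertion step of a sort: given a way to sort all initial words of length n, put a word
  -- a ∷ r with |r| = n in rising order, by well-founded induction on its first letter a.
  module Insertion (n : ℕ)
    (sort-n : ∀ {g} w → length w ≡ n → IsReduced g w → Initial w → RisingFactorization g) where

    insert : ∀ {g} a → Acc _⊏_ a → ∀ r → length r ≡ n → IsReduced g (a ∷ r) → Initial (a ∷ r) →
      RisingFactorization g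
    -- a in front of a rising word b ∷ t: done if a ⪯ b, otherwise descend on the prefix (a, b)
    -- to a smaller first letter m and insert again.
    place : ∀ {g} a → Acc _⊏_ a → ∀ b t → length (b ∷ t) ≡ n → IsReduced g (a ∷ b ∷ t) →
      Initial (a ∷ b ∷ t) → Rising (b ∷ t) → RisingFactorization g

    insert a rec r |r| R I with sort-n r |r| (suffix-reduced (a ∷ []) r R) (Initial-suffix (a ∷ []) r I)
    ... | [] , _ , Rr = a ∷ [] , rising-[x] a , replace-suffix (a ∷ []) r [] R Rr
    ... | b ∷ t , ris , Rr =
      place a rec b t (≡.trans (≡.sym (reduced-length (suffix-reduced (a ∷ []) r R) Rr)) |r|) R' (Initial-reduced R I R') ris
      where
      R' : IsReduced _ (a ∷ b ∷ t)
      R' = replace-suffix (a ∷ []) r (b ∷ t) R Rr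

    place a (acc rec) b t |bt| R I ris
      with ≺-trichotomy (head-in-Ac R I) (head-in-Ac (suffix-reduced (a ∷ []) (b ∷ t) R) (Initial-suffix (a ∷ []) (b ∷ t) I))
    ... | inj₁ a≺b = a ∷ b ∷ t , rising-∷ a b t (inj₁ a≺b) ris , R
    ... | inj₂ (inj₁ a≈b) = a ∷ b ∷ t , rising-∷ a b t (inj₂ a≈b) ris , R
    ... | inj₂ (inj₂ b≺a) with descend (prefix-reduced (a ∷ b ∷ []) t R) (Initial-prefix (a ∷ b ∷ []) t I) b≺a
    ... | m , m' , (_ , Rm) , m≺a = insert m (rec (head-in-Ac R' I' , m≺a)) (m' ∷ t) |bt| R' I'
      where
      R' : IsReduced _ (m ∷ m' ∷ t)
      R' = replace-prefix (a ∷ b ∷ []) t (m ∷ m' ∷ []) R Rm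
      I' : Initial (m ∷ m' ∷ t)
      I' = Initial-reduced R I R'

  sort : ∀ n {g} w → length w ≡ n → IsReduced g w → Initial w → RisingFactorization g
  sort zero    []      _   R _ = [] , rising-[] , R
  sort (suc n) (a ∷ r) |w| R I =
    Insertion.insert n (sort n) a (⊏-wellFounded a (head-in-Ac R I)) r (suc-injective |w|) R I

  exactly-one-rising : ∀ {g} w → IsReduced g w → Initial w → ExactlyOne (RisingReduced g)
  exactly-one-rising w R I with sort (length w) w ≡.refl R I
  ... | w₀ , RR₀ = w₀ , RR₀ , λ w' RR' → rising-unique w₀ w' (Initial-reduced R I (proj₂ RR₀)) RR₀ RR'

-- Proposition 5.22. For x ≤ y ≤ c₀ write a reduced word of y as u ++ v with prod u ≈ x; then v
-- is a reduced word of x⁻¹y lying in the interval [e, c₀], which has exactly one rising reduced word.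
proposition5p22 : ∀ {c ℓ a r : Level} (G : Group c ℓ) (A : Group.Carrier G → Set a)
    → Theory.RespectsEq G A
    → Theory.MonoidGenerates G A
    → Theory.ConjugationClosed G A
    → (c₀ : Group.Carrier G)
    → Theory.RedFinite G A c₀
    → (_≺_ : Group.Carrier G → Group.Carrier G → Set r)
    → Theory.Order.IsLinearOrderOn G A _≺_ c₀
    → Theory.Order.Compatible G A _≺_ c₀
    → Theory.Order.TotallyWellCovered G A _≺_ c₀
    → ∀ x y → Theory._≤A_ G A x y → Theory._≤A_ G A y c₀
    → Theory.ExactlyOne G A (Theory.Order.RisingReduced G A _≺_ (Group._∙_ G (Group._⁻¹ G x) y))
proposition5p22 G A respA _ conjA c₀ finite _≺_ linear compatible totally x y x≤y y≤c₀ =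
  let (u , v , Ry , ux) = ≤A-elim x≤y in
  exactly-one-rising v (suffix-quotient u v Ry ux) (Initial-suffix u v (≤c₀⇒Initial y≤c₀ Ry))
  where
  open Factorizations G A respA conjA
  open RisingFactorizations G A respA conjA c₀ finite _≺_ linear compatible totally
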